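{- Let $N = \{a,b,c,d,e,f,g,h\}$ be a set of eight distinct elements and let $G = \{\{a,b,c\}, \{a,d,g\}, \{b,d,f\}, \{b,e,h\}, \{b,g\}, \{c,e,g\}, \{f,g,h\}\}$. In the game in which Black and White alternately claim previously unclaimed elements of $N$, Black moving first, until all of $N$ is claimed, White has a strategy guaranteeing that every set in $G$ contains at least one element claimed by White.
   Context: This is the "FlatStar/Line Configuration". It is the FlatStar Configuration, whose groups are $\{a,b,c\},\{a,d,g\},\{b,d,f\},\{b,e,h\},\{c,e,g\},\{f,g,h\}$, with one added group whose only markers are $b$ and $g$. The elements of $N$ are called markers, and the sets in $G$ are the traces on the markers of groups (possible winning lines) of a $k$-in-a-Row game. -}

module Defs where

open import Data.Fin using (Fin; zero; suc)
open import Data.Vec using (Vec; lookup; _[_]≔_; replicate)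
open import Data.List using (List; []; _∷_)
open import Data.List.Relation.Unary.All using (All)
open import Data.List.Relation.Unary.Any using (Any)
open import Data.Product using (Σ; _×_)
open import Relation.Binary.PropositionalEquality using (_≡_; _≢_)

Marker : Set
Marker = Fin 8

a b c d e f g h : Marker
a = zero
b = suc zero
c = suc (suc zero)
d = suc (suc (suc zero))
e = suc (suc (suc (suc zero)))
f = suc (suc (suc (suc (suc zero))))
g = suc (suc (suc (suc (suc (suc zero)))))
h = suc (suc (suc (suc (suc (suc (suc zero))))))

Groups : List (List Marker)
Groups = (a ∷ b ∷ c ∷ []) ∷ (a ∷ d ∷ g ∷ []) ∷ (b ∷ d ∷ f ∷ []) ∷ (b ∷ e ∷ h ∷ [])
       ∷ (b ∷ g ∷ []) ∷ (c ∷ e ∷ g ∷ []) ∷ (f ∷ g ∷ h ∷ []) ∷ []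

data Cell : Set where
  free black white : Cell

Board : Set
Board = Vec Cell 8

emptyBoard : Board
emptyBoard = replicate 8 free

Full : Board → Set
Full bd = (i : Marker) → lookup bd i ≢ free

WhiteBlocksAll : Board → Set
WhiteBlocksAll bd = All (Any (λ i → lookup bd i ≡ white)) Groups

-- White has a strategy (from the given position) guaranteeing that,
-- when all markers are claimed, every group contains a White marker.
mutual
  data WhiteWinsBlackToMove (bd : Board) : Set where
    over : Full bd → WhiteBlocksAll bd → WhiteWinsBlackToMove bd
    move : Σ Marker (λ i → lookup bd i ≡ free)
         → ((i : Marker) → lookup bd i ≡ free → WhiteWinsWhiteToMove (bd [ i ]≔ black))
         → WhiteWinsBlackToMove bd

  data WhiteWinsWhiteToMove (bd : Board) : Set where
    over : Full bd → WhiteBlocksAll bd → WhiteWinsWhiteToMove bd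
    move : (i : Marker) → lookup bd i ≡ free
         → WhiteWinsBlackToMove (bd [ i ]≔ white)
         → WhiteWinsWhiteToMove bd

-- The heart of the argument is the classical pairing strategy: if the free
-- markers are matched in pairs and every group not yet blocked by White
-- contains a whole pair of free markers, then White wins by always answering
-- Black's marker with its partner.
--
-- The configuration itself has no pairing strategy from the empty board
-- (the group {b,g} forces a pair {b,g}, after which {a,b,c} and {a,d,g}
-- compete for a), so White's first answer is special: against b White takes
-- g, and against any other marker White takes b.  Afterwards a pairing
-- strategy exists (`answer` lists it); this finite fact is checked by a
-- decision procedure, and the main theorem combines the two.
module Submission where

open import Defs
open import Data.Nat using (ℕ; zero; suc; _≤_; z≤n; s≤s)
open import Data.Nat.Properties using (≤-pred; m≤n⇒m≤1+n; 1+n≢0; n≤0⇒n≡0)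
open import Data.Fin using (zero; suc; _≟_)
open import Data.Fin.Properties using (all?; any?)
open import Data.Vec using (Vec; []; _∷_; lookup; _[_]≔_)
open import Data.Vec.Properties using (lookup∘update; lookup∘update′)
open import Data.List using (List; []; _∷_)
open import Data.List.Membership.Propositional using (_∈_; lose)
open import Data.List.Membership.DecPropositional (_≟_ {8}) using (_∈?_)
open import Data.List.Relation.Unary.All as All using (All)
open import Data.List.Relation.Unary.Any using (Any)
open import Data.Product using (∃; _×_; _,_; proj₁; proj₂)
open import Data.Sum using (_⊎_; inj₁; inj₂)
open import Data.Bool using (if_then_else_)
open import Data.Empty using (⊥-elim)
open import Relation.Nullary using (Dec; yes; no; does; ¬?)
open import Relation.Nullary.Decidable using (toWitness; map′; _×-dec_; _⊎-dec_; _→-dec_)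
open import Relation.Binary.PropositionalEquality using (_≡_; _≢_; refl; sym; trans; cong; subst)

isFree? : (x : Cell) → Dec (x ≡ free)
isFree? free  = yes refl
isFree? black = no λ ()
isFree? white = no λ ()

isWhite? : (x : Cell) → Dec (x ≡ white)
isWhite? free  = no λ ()
isWhite? black = no λ ()
isWhite? white = yes refl

-- Number of free cells; the measure that makes the game finite.
freeCount : ∀ {n} → Vec Cell n → ℕ
freeCount []           = zero
freeCount (free  ∷ v) = suc (freeCount v)
freeCount (black ∷ v) = freeCount v
freeCount (white ∷ v) = freeCount v

freeCount≤length : ∀ {n} (v : Vec Cell n) → freeCount v ≤ n
freeCount≤length []          = z≤n
freeCount≤length (free  ∷ v) = s≤s (freeCount≤length v)
freeCount≤length (black ∷ v) = m≤n⇒m≤1+n (freeCount≤length v)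
freeCount≤length (white ∷ v) = m≤n⇒m≤1+n (freeCount≤length v)

claim-decreases : ∀ {n} (v : Vec Cell n) i {x} → lookup v i ≡ free → x ≢ free →
                  suc (freeCount (v [ i ]≔ x)) ≡ freeCount v
claim-decreases (free ∷ v) zero {free}  refl x≢free = ⊥-elim (x≢free refl)
claim-decreases (free ∷ v) zero {black} refl _      = refl
claim-decreases (free ∷ v) zero {white} refl _      = refl
claim-decreases (free  ∷ v) (suc i) i-free x≢free = cong suc (claim-decreases v i i-free x≢free)
claim-decreases (black ∷ v) (suc i) i-free x≢free = claim-decreases v i i-free x≢free
claim-decreases (white ∷ v) (suc i) i-free x≢free = claim-decreases v i i-free x≢free

claim-shrinks : ∀ {n m} (v : Vec Cell n) i {x} → lookup v i ≡ free → x ≢ free →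
                freeCount v ≤ suc m → freeCount (v [ i ]≔ x) ≤ m
claim-shrinks v i i-free x≢free bound =
  ≤-pred (subst (_≤ suc _) (sym (claim-decreases v i i-free x≢free)) bound)

exhausted : ∀ {n} (v : Vec Cell n) → freeCount v ≤ 0 → ∀ i → lookup v i ≢ free
exhausted v bound i i-free = 1+n≢0 (trans (claim-decreases v i {black} i-free (λ ())) (n≤0⇒n≡0 bound))

unchanged : ∀ {n} (v : Vec Cell n) {i j x} → i ≢ j → lookup (v [ j ]≔ x) i ≡ lookup v i
unchanged v i≢j = lookup∘update′ i≢j v _

free-after-claim : ∀ {n} (v : Vec Cell n) {i j x} → x ≢ free →
                   lookup (v [ j ]≔ x) i ≡ free → i ≢ j × lookup v i ≡ free
free-after-claim v {i} {j} {x} x≢free i-free with i ≟ j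
... | yes refl = ⊥-elim (x≢free (trans (sym (lookup∘update i v x)) i-free))
... | no i≢j   = i≢j , trans (sym (unchanged v i≢j)) i-free

claimed-stays : ∀ {n} (v : Vec Cell n) {i j x y} → y ≢ free → lookup v j ≡ free →
                lookup v i ≡ y → lookup (v [ j ]≔ x) i ≡ y
claimed-stays v {i} {j} y≢free j-free i-y with i ≟ j
... | yes refl = ⊥-elim (y≢free (trans (sym i-y) j-free))
... | no i≢j   = trans (unchanged v i≢j) i-y

WhiteIn : Board → List Marker → Set
WhiteIn bd gr = ∃ λ i → i ∈ gr × lookup bd i ≡ white

FreePairIn : (Marker → Marker) → Board → List Marker → Set
FreePairIn p bd gr = ∃ λ i → i ∈ gr × p i ∈ gr × lookup bd i ≡ free

record PairingStrategy (p : Marker → Marker) (bd : Board) : Set where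
  field
    partner-free       : ∀ i → lookup bd i ≡ free → lookup bd (p i) ≡ free
    partner-distinct   : ∀ i → lookup bd i ≡ free → p i ≢ i
    partner-involutive : ∀ i → lookup bd i ≡ free → p (p i) ≡ i
    covered            : All (λ gr → WhiteIn bd gr ⊎ FreePairIn p bd gr) Groups
open PairingStrategy

reply : (Marker → Marker) → Board → Marker → Board
reply p bd j = (bd [ j ]≔ black) [ p j ]≔ white

partner-still-free : ∀ {p bd j} → PairingStrategy p bd → lookup bd j ≡ free →
                     lookup (bd [ j ]≔ black) (p j) ≡ free
partner-still-free {bd = bd} ps j-free =
  trans (unchanged bd (partner-distinct ps _ j-free)) (partner-free ps _ j-free)

-- Answering with the partner preserves the pairing strategy: only the pair
-- {j, p j} disappears, and any group relying on it now contains White's p j.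
pairing-preserved : ∀ {p bd j} → PairingStrategy p bd → lookup bd j ≡ free →
                    PairingStrategy p (reply p bd j)
pairing-preserved {p} {bd} {j} ps j-free = record
  { partner-free       = λ i i-free → let (i≢j , i≢pj , i-free₀) = origin i-free in
                         still-free (partner-free ps i i-free₀)
                           (λ pi≡j → i≢pj (trans (sym (inv i-free₀)) (cong p pi≡j)))
                           (λ pi≡pj → i≢j (trans (sym (inv i-free₀)) (trans (cong p pi≡pj) (inv j-free))))
  ; partner-distinct   = λ i i-free → partner-distinct ps i (proj₂ (proj₂ (origin i-free)))
  ; partner-involutive = λ i i-free → inv (proj₂ (proj₂ (origin i-free)))
  ; covered            = All.map still-covered (covered ps)
  }
  where
  bd₁ = bd [ j ]≔ black
  pj-free : lookup bd₁ (p j) ≡ free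
  pj-free = partner-still-free ps j-free

  inv : ∀ {i} → lookup bd i ≡ free → p (p i) ≡ i
  inv = partner-involutive ps _

  origin : ∀ {i} → lookup (reply p bd j) i ≡ free → i ≢ j × i ≢ p j × lookup bd i ≡ free
  origin i-free with free-after-claim bd₁ (λ ()) i-free
  ... | i≢pj , i-free₁ with free-after-claim bd (λ ()) i-free₁
  ...   | i≢j , i-free₀ = i≢j , i≢pj , i-free₀

  still-free : ∀ {i} → lookup bd i ≡ free → i ≢ j → i ≢ p j → lookup (reply p bd j) i ≡ free
  still-free i-free i≢j i≢pj = trans (unchanged bd₁ i≢pj) (trans (unchanged bd i≢j) i-free)

  answered : lookup (reply p bd j) (p j) ≡ white
  answered = lookup∘update (p j) bd₁ white

  still-covered : ∀ {gr} → WhiteIn bd gr ⊎ FreePairIn p bd gr →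
                  WhiteIn (reply p bd j) gr ⊎ FreePairIn p (reply p bd j) gr
  still-covered (inj₁ (i , i∈gr , i-white)) =
    inj₁ (i , i∈gr , claimed-stays bd₁ (λ ()) pj-free (claimed-stays bd (λ ()) j-free i-white))
  still-covered (inj₂ (i , i∈gr , pi∈gr , i-free)) with i ≟ j | i ≟ p j
  ... | yes refl | _        = inj₁ (p i , pi∈gr , answered)
  ... | no _     | yes refl = inj₁ (p j , i∈gr , answered)
  ... | no i≢j   | no i≢pj  = inj₂ (i , i∈gr , pi∈gr , still-free i-free i≢j i≢pj)

endgame : ∀ {p bd} → PairingStrategy p bd → Full bd → WhiteBlocksAll bd
endgame {p} {bd} ps full = All.map blocked (covered ps)
  where
  blocked : ∀ {gr} → WhiteIn bd gr ⊎ FreePairIn p bd gr → Any (λ i → lookup bd i ≡ white) gr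
  blocked (inj₁ (i , i∈gr , i-white)) = lose i∈gr i-white
  blocked (inj₂ (i , _ , _ , i-free)) = ⊥-elim (full i i-free)

pairingWins : ∀ {p} n bd → freeCount bd ≤ n → PairingStrategy p bd → WhiteWinsBlackToMove bd
pairingWins zero bd bound ps = over full (endgame ps full)
  where full = exhausted bd bound
pairingWins {p} (suc n) bd bound ps with any? (λ i → isFree? (lookup bd i))
... | no noFree = over full (endgame ps full)
  where full = λ i i-free → noFree (i , i-free)
... | yes some = move some respond
  where
  respond : ∀ i → lookup bd i ≡ free → WhiteWinsWhiteToMove (bd [ i ]≔ black)
  respond i i-free = move (p i) (partner-still-free ps i-free)
    (pairingWins n (reply p bd i) shrinks (pairing-preserved ps i-free))
    where
    shrinks : freeCount (reply p bd i) ≤ n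
    shrinks = claim-shrinks (bd [ i ]≔ black) (p i) (partner-still-free ps i-free) (λ ())
                (m≤n⇒m≤1+n (claim-shrinks bd i i-free (λ ()) bound))

pairingStrategy? : ∀ p bd → Dec (PairingStrategy p bd)
pairingStrategy? p bd =
  map′ (λ (pf , pd , pi , cv) → record { partner-free = pf ; partner-distinct = pd
                                        ; partner-involutive = pi ; covered = cv })
       (λ ps → partner-free ps , partner-distinct ps , partner-involutive ps , covered ps)
       ( all? (λ i → isFree? (lookup bd i) →-dec isFree? (lookup bd (p i)))
   ×-dec all? (λ i → isFree? (lookup bd i) →-dec ¬? (p i ≟ i))
   ×-dec all? (λ i → isFree? (lookup bd i) →-dec p (p i) ≟ i)
   ×-dec All.all? (λ gr → whiteIn? gr ⊎-dec freePairIn? gr) Groups)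
  where
  whiteIn? : ∀ gr → Dec (WhiteIn bd gr)
  whiteIn? gr = any? (λ i → i ∈? gr ×-dec isWhite? (lookup bd i))
  freePairIn? : ∀ gr → Dec (FreePairIn p bd gr)
  freePairIn? gr = any? (λ i → i ∈? gr ×-dec p i ∈? gr ×-dec isFree? (lookup bd i))

pairUp : List (Marker × Marker) → Marker → Marker
pairUp []             i = i
pairUp ((x , y) ∷ ps) i = if does (i ≟ x) then y else if does (i ≟ y) then x else pairUp ps i

-- Once White owns b, the groups left are {a,d,g}, {c,e,g} and {f,g,h};
-- these pairs are what remains of them after removing g.
throughG : List (Marker × Marker)
throughG = (a , d) ∷ (c , e) ∷ (f , h) ∷ []

-- White's answer to Black's first marker x, and the pairing used afterwards:
-- against b, White takes g and pairs the rest of {a,b,c}, {b,d,f}, {b,e,h};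
-- against g, White takes b and pairs along throughG; against any other x,
-- White takes b and pairs the partner of x with g instead of with x.
answer : Marker → Marker × (Marker → Marker)
answer x with x ≟ b | x ≟ g
... | yes _ | _     = g , pairUp ((a , c) ∷ (d , f) ∷ (e , h) ∷ [])
... | no _  | yes _ = b , pairUp throughG
... | no _  | no _  = b , pairUp ((pairUp throughG x , g) ∷ throughG)

afterOpening : Marker → Board
afterOpening x = (emptyBoard [ x ]≔ black) [ proj₁ (answer x) ]≔ white

ValidAnswer : Marker → Set
ValidAnswer x = lookup (emptyBoard [ x ]≔ black) (proj₁ (answer x)) ≡ free
              × PairingStrategy (proj₂ (answer x)) (afterOpening x)

answers-valid : ∀ x → ValidAnswer x
answers-valid = toWitness {a? = all? λ x → isFree? _ ×-dec pairingStrategy? _ _} _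

mainTheorem10 : WhiteWinsBlackToMove emptyBoard
mainTheorem10 = move (a , refl) λ x _ →
  let (answer-free , wins-by-pairing) = answers-valid x in
  move (proj₁ (answer x)) answer-free
       (pairingWins 8 (afterOpening x) (freeCount≤length (afterOpening x)) wins-by-pairing)
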